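{- If we have $t\to_\beta u$, then we have that $[\![t]\!]\ge[\![u]\!]$.
   Context: Let $\mathcal{C}$ be a strict monoidal closed category, not necessarily symmetric, with the following structure. - Enrichment: $\mathcal{C}$ is enriched in posets, so hom-sets are posets and composition, $\otimes$ and currying $\Lambda_{X,Y,Z}:\mathrm{Hom}(X\otimes Y,Z)\cong\mathrm{Hom}(X,Y\multimap Z)$ are monotone. - Closed structure: $\mathrm{ev}_{Y,Z}:(Y\multimap Z)\otimes Y\to Z$ denotes evaluation. - Bottom maps: there are least elements $\bot_X\in\mathrm{Hom}(X,I)$, where $I$ is the tensor unit, with $\bot_X\otimes\bot_Y=\bot_{X\otimes Y}$ and $\bot_I=\mathrm{id}_I$. Consider purely affine planar $\lambda$-terms: types are built from a base type $\mathtt{o}$ with $\multimap$. Judgements have the form $\underline{\Gamma};\Delta\vdash t:\tau$, with $\underline{\Gamma}$ a signature of duplicable constants and $\Delta$ an ordered list of affine variables. The typing rules are: - constant rule: $\underline{\Gamma};\Delta\vdash x:\tau$ for $x:\tau$ in $\underline{\Gamma}$; - variable rule: $\underline{\Gamma};\Delta,x:\tau,\Delta'\vdash x:\tau$; - abstraction: from $\Delta,x:\tau\vdash t:\sigma$ infer $\Delta\vdash\lambda x.t:\tau\multimap\sigma$; - application: from $\Delta\vdash t:\tau\multimap\sigma$ and $\Delta'\vdash u:\tau$ infer $\Delta,\Delta'\vdash t\,u:\sigma$. $\to_\beta$ is the congruence closure of $(\lambda x.t)\,u\to_\beta t[u/x]$ on well-typed terms. Given an object $[\![\mathtt{o}]\!]$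 and morphisms $[\![x]\!]:I\to[\![\tau]\!]$ for constants, terms are interpreted as follows: - types: $[\![\tau\multimap\sigma]\!]=[\![\tau]\!]\multimap[\![\sigma]\!]$; - contexts: $[\![\cdot]\!]=I$ and $[\![\Delta,x:\tau]\!]=[\![\Delta]\!]\otimes[\![\tau]\!]$; - constant $\mapsto[\![x]\!]\circ\bot_{[\![\Delta]\!]}$; - variable $\mapsto\bot_{[\![\Delta]\!]}\otimes\mathrm{id}_{[\![\tau]\!]}\otimes\bot_{[\![\Delta']\!]}$; - abstraction $\mapsto\Lambda([\![t]\!])$; - application $\mapsto\mathrm{ev}\circ([\![t]\!]\otimes[\![u]\!])$. -}

module Defs where

open import Level using (Level; _⊔_) renaming (suc to lsuc)
open import Data.Product using (Σ; Σ-syntax; _×_; _,_)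
open import Relation.Binary.PropositionalEquality
  using (_≡_; refl; sym; trans; cong; subst; subst₂)
open import Relation.Binary.Structures using (IsPartialOrder)

record PosetStrictMonClosed (o ℓ e : Level) : Set (lsuc (o ⊔ ℓ ⊔ e)) where
  infixr 9 _∘_
  infixl 10 _⊗₀_ _⊗₁_
  infixr 8 _⊸_
  infix 4 _≤_
  field
    Obj  : Set o
    Hom  : Obj → Obj → Set ℓ
    id   : ∀ {A} → Hom A A
    _∘_  : ∀ {A B C} → Hom B C → Hom A B → Hom A C
    identityˡ : ∀ {A B} {f : Hom A B} → id ∘ f ≡ f
    identityʳ : ∀ {A B} {f : Hom A B} → f ∘ id ≡ f
    assoc     : ∀ {A B C D} {f : Hom C D} {g : Hom B C} {h : Hom A B}
              → (f ∘ g) ∘ h ≡ f ∘ (g ∘ h)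

    _≤_  : ∀ {A B} → Hom A B → Hom A B → Set e
    ≤-isPartialOrder : ∀ {A B} → IsPartialOrder (_≡_ {A = Hom A B}) _≤_

    I     : Obj
    _⊗₀_  : Obj → Obj → Obj
    _⊗₁_  : ∀ {A B C D} → Hom A B → Hom C D → Hom (A ⊗₀ C) (B ⊗₀ D)
    ⊗-id  : ∀ {A B} → id {A} ⊗₁ id {B} ≡ id
    ⊗-∘   : ∀ {A B C A′ B′ C′} {f : Hom B C} {g : Hom A B}
              {f′ : Hom B′ C′} {g′ : Hom A′ B′}
          → (f ∘ g) ⊗₁ (f′ ∘ g′) ≡ (f ⊗₁ f′) ∘ (g ⊗₁ g′)
    assoc₀  : ∀ {A B C} → (A ⊗₀ B) ⊗₀ C ≡ A ⊗₀ (B ⊗₀ C)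
    unitˡ₀  : ∀ {A} → I ⊗₀ A ≡ A
    unitʳ₀  : ∀ {A} → A ⊗₀ I ≡ A
    assoc₁  : ∀ {A B C D E F} {f : Hom A B} {g : Hom C D} {h : Hom E F}
            → subst₂ Hom assoc₀ assoc₀ ((f ⊗₁ g) ⊗₁ h) ≡ f ⊗₁ (g ⊗₁ h)
    unitˡ₁  : ∀ {A B} {f : Hom A B}
            → subst₂ Hom unitˡ₀ unitˡ₀ (id {I} ⊗₁ f) ≡ f
    unitʳ₁  : ∀ {A B} {f : Hom A B}
            → subst₂ Hom unitʳ₀ unitʳ₀ (f ⊗₁ id {I}) ≡ f

    _⊸_  : Obj → Obj → Obj
    ev   : ∀ {Y Z} → Hom ((Y ⊸ Z) ⊗₀ Y) Z
    Λ    : ∀ {X Y Z} → Hom (X ⊗₀ Y) Z → Hom X (Y ⊸ Z)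
    Λ-β  : ∀ {X Y Z} {f : Hom (X ⊗₀ Y) Z} → ev ∘ (Λ f ⊗₁ id) ≡ f
    Λ-η  : ∀ {X Y Z} {g : Hom X (Y ⊸ Z)} → Λ (ev ∘ (g ⊗₁ id)) ≡ g

    ∘-mono : ∀ {A B C} {f f′ : Hom B C} {g g′ : Hom A B}
           → f ≤ f′ → g ≤ g′ → f ∘ g ≤ f′ ∘ g′
    ⊗-mono : ∀ {A B C D} {f f′ : Hom A B} {g g′ : Hom C D}
           → f ≤ f′ → g ≤ g′ → f ⊗₁ g ≤ f′ ⊗₁ g′
    Λ-mono : ∀ {X Y Z} {f f′ : Hom (X ⊗₀ Y) Z} → f ≤ f′ → Λ f ≤ Λ f′

    bot       : ∀ X → Hom X I
    bot-least : ∀ {X} (f : Hom X I) → bot X ≤ f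
    bot-⊗     : ∀ {X Y} → subst (Hom (X ⊗₀ Y)) unitˡ₀ (bot X ⊗₁ bot Y) ≡ bot (X ⊗₀ Y)
    bot-I     : bot I ≡ id

infixr 8 _⇒_
data Ty : Set where
  o   : Ty
  _⇒_ : Ty → Ty → Ty

infixl 5 _▸_
data Ctx : Set where
  ∙   : Ctx
  _▸_ : Ctx → Ty → Ctx

infixl 6 _++_
_++_ : Ctx → Ctx → Ctx
Δ ++ ∙        = Δ
Δ ++ (Δ′ ▸ τ) = (Δ ++ Δ′) ▸ τ

++-assoc : ∀ Δ₁ Δ₂ Δ₃ → (Δ₁ ++ Δ₂) ++ Δ₃ ≡ Δ₁ ++ (Δ₂ ++ Δ₃)
++-assoc Δ₁ Δ₂ ∙        = refl
++-assoc Δ₁ Δ₂ (Δ₃ ▸ τ) = cong (_▸ τ) (++-assoc Δ₁ Δ₂ Δ₃)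

-- Typing derivations of purely affine planar terms over a signature
-- K of duplicable constants (K τ = constants of type τ).
-- Term K Δ τ  is a derivation of   Γ ; Δ ⊢ t : τ .

module Syntax (K : Ty → Set) where

  data Term (Δ : Ctx) : Ty → Set where
    con : ∀ {τ} → K τ → Term Δ τ
    var : ∀ {τ} (Δ₁ Δ₂ : Ctx) → Δ ≡ (Δ₁ ▸ τ) ++ Δ₂ → Term Δ τ
    lam : ∀ {τ σ} → Term (Δ ▸ τ) σ → Term Δ (τ ⇒ σ)
    app : ∀ {τ σ} (Δ₁ Δ₂ : Ctx) → Δ ≡ Δ₁ ++ Δ₂
        → Term Δ₁ (τ ⇒ σ) → Term Δ₂ τ → Term Δ σ

  data _⊑_ : Ctx → Ctx → Set where
    done : ∙ ⊑ ∙
    keep : ∀ {Δ Θ τ} → Δ ⊑ Θ → (Δ ▸ τ) ⊑ (Θ ▸ τ)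
    drop : ∀ {Δ Θ τ} → Δ ⊑ Θ → Δ ⊑ (Θ ▸ τ)

  dropAll : ∀ Θ → ∙ ⊑ Θ
  dropAll ∙       = done
  dropAll (Θ ▸ τ) = drop (dropAll Θ)

  padL : ∀ Θl Δ → Δ ⊑ (Θl ++ Δ)
  padL Θl ∙       = dropAll Θl
  padL Θl (Δ ▸ τ) = keep (padL Θl Δ)

  padR : ∀ {Δ Θ} → Δ ⊑ Θ → ∀ Θr → Δ ⊑ (Θ ++ Θr)
  padR e ∙        = e
  padR e (Θr ▸ τ) = drop (padR e Θr)

  splitOPE : ∀ {Θ} Δa Δb → (Δa ++ Δb) ⊑ Θ
           → Σ[ Θa ∈ Ctx ] Σ[ Θb ∈ Ctx ] (Δa ⊑ Θa × Δb ⊑ Θb × Θ ≡ Θa ++ Θb)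
  splitOPE {Θ} Δa ∙ e = Θ , ∙ , e , done , refl
  splitOPE Δa (Δb ▸ τ) (keep e) with splitOPE Δa Δb e
  ... | Θa , Θb , ea , eb , eq = Θa , (Θb ▸ τ) , ea , keep eb , cong (_▸ τ) eq
  splitOPE Δa (Δb ▸ τ) (drop {τ = ρ} e) with splitOPE Δa (Δb ▸ τ) e
  ... | Θa , Θb , ea , eb , eq = Θa , (Θb ▸ ρ) , ea , drop eb , cong (_▸ ρ) eq

  varPos : ∀ {Δ τ Θ} → (Δ ▸ τ) ⊑ Θ → Σ[ Θ₁ ∈ Ctx ] Σ[ Θ₂ ∈ Ctx ] (Θ ≡ (Θ₁ ▸ τ) ++ Θ₂)
  varPos (keep {Θ = Θ} e) = Θ , ∙ , refl
  varPos (drop {τ = ρ} e) with varPos e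
  ... | Θ₁ , Θ₂ , eq = Θ₁ , (Θ₂ ▸ ρ) , cong (_▸ ρ) eq

  rename : ∀ {Δ Θ σ} → Term Δ σ → Δ ⊑ Θ → Term Θ σ
  rename (con c) e = con c
  rename {Θ = Θ} (var {τ} Δ₁ Δ₂ eq) e
    with splitOPE (Δ₁ ▸ τ) Δ₂ (subst (_⊑ Θ) eq e)
  ... | Θa , Θb , ea , eb , eqΘ with varPos ea
  ... | Θ₁ , Θ₂ , eqa =
    var Θ₁ (Θ₂ ++ Θb)
        (trans eqΘ (trans (cong (_++ Θb) eqa) (++-assoc (Θ₁ ▸ τ) Θ₂ Θb)))
  rename (lam t) e = lam (rename t (keep e))
  rename {Θ = Θ} (app Δ₁ Δ₂ eq t u) e with splitOPE Δ₁ Δ₂ (subst (_⊑ Θ) eq e)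
  ... | Θa , Θb , ea , eb , eqΘ = app Θa Θb eqΘ (rename t ea) (rename u eb)

  -- simultaneous (planar) substitutions:  Sub Δ Θ  assigns to the i-th
  -- variable of Δ a term in context Θᵢ, where Θ = Θ₁ ++ … ++ Θₙ
  infixl 5 _▷_
  data Sub : Ctx → Ctx → Set where
    ε   : Sub ∙ ∙
    _▷_ : ∀ {Δ Θ Θ′ τ} → Sub Δ Θ → Term Θ′ τ → Sub (Δ ▸ τ) (Θ ++ Θ′)

  idSub : ∀ Δ → Sub Δ Δ
  idSub ∙       = ε
  idSub (Δ ▸ τ) = idSub Δ ▷ var ∙ ∙ refl

  splitSub : ∀ {Θ} Δa Δb → Sub (Δa ++ Δb) Θ
           → Σ[ Θa ∈ Ctx ] Σ[ Θb ∈ Ctx ] (Sub Δa Θa × Sub Δb Θb × Θ ≡ Θa ++ Θb)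
  splitSub {Θ} Δa ∙ s = Θ , ∙ , s , ε , refl
  splitSub Δa (Δb ▸ τ) (_▷_ {Θ′ = Θ′} s t) with splitSub Δa Δb s
  ... | Θa , Θb , sa , sb , eq =
    Θa , (Θb ++ Θ′) , sa , (sb ▷ t) , trans (cong (_++ Θ′) eq) (++-assoc Θa Θb Θ′)

  -- the variable case: the substituted term, weakened by the contexts
  -- of the other (discarded) variables
  varSub : ∀ {Δ₁ τ Θa} → Sub (Δ₁ ▸ τ) Θa → ∀ Θb → Term (Θa ++ Θb) τ
  varSub (_▷_ {Θ = Θ₁} {Θ′ = Θu} s u) Θb = rename u (padR (padL Θ₁ Θu) Θb)

  sub : ∀ {Δ Θ σ} → Term Δ σ → Sub Δ Θ → Term Θ σ
  sub (con c) s = con c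
  sub {Θ = Θ} {σ} (var {τ} Δ₁ Δ₂ eq) s
    with splitSub (Δ₁ ▸ τ) Δ₂ (subst (λ D → Sub D Θ) eq s)
  ... | Θa , Θb , sa , sb , eqΘ = subst (λ D → Term D σ) (sym eqΘ) (varSub sa Θb)
  sub (lam t) s = lam (sub t (s ▷ var ∙ ∙ refl))
  sub {Θ = Θ} (app Δ₁ Δ₂ eq t u) s
    with splitSub Δ₁ Δ₂ (subst (λ D → Sub D Θ) eq s)
  ... | Θa , Θb , sa , sb , eqΘ = app Θa Θb eqΘ (sub t sa) (sub u sb)

  _[_/x] : ∀ {Δ₁ Δ₂ τ σ} → Term (Δ₁ ▸ τ) σ → Term Δ₂ τ → Term (Δ₁ ++ Δ₂) σ
  _[_/x] {Δ₁} t u = sub t (idSub Δ₁ ▷ u)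

  infix 3 _→β_
  data _→β_ {Δ : Ctx} : ∀ {σ} → Term Δ σ → Term Δ σ → Set where
    β     : ∀ {Δ₁ Δ₂ τ σ} (eq : Δ ≡ Δ₁ ++ Δ₂)
              (t : Term (Δ₁ ▸ τ) σ) (u : Term Δ₂ τ)
          → app Δ₁ Δ₂ eq (lam t) u →β subst (λ D → Term D σ) (sym eq) (t [ u /x])
    ξ-lam : ∀ {τ σ} {t t′ : Term (Δ ▸ τ) σ} → t →β t′ → lam t →β lam t′
    ξ-appˡ : ∀ {Δ₁ Δ₂ τ σ} (eq : Δ ≡ Δ₁ ++ Δ₂)
               {t t′ : Term Δ₁ (τ ⇒ σ)} {u : Term Δ₂ τ}
           → t →β t′ → app Δ₁ Δ₂ eq t u →β app Δ₁ Δ₂ eq t′ u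
    ξ-appʳ : ∀ {Δ₁ Δ₂ τ σ} (eq : Δ ≡ Δ₁ ++ Δ₂)
               {t : Term Δ₁ (τ ⇒ σ)} {u u′ : Term Δ₂ τ}
           → u →β u′ → app Δ₁ Δ₂ eq t u →β app Δ₁ Δ₂ eq t u′

module Semantics {lo lh le : Level} (𝒞 : PosetStrictMonClosed lo lh le)
                 (K : Ty → Set) where
  open PosetStrictMonClosed 𝒞
  open Syntax K

  module Interp (⟦o⟧ : Obj) where

    ⟦_⟧ty : Ty → Obj
    ⟦ o ⟧ty     = ⟦o⟧
    ⟦ τ ⇒ σ ⟧ty = ⟦ τ ⟧ty ⊸ ⟦ σ ⟧ty

    ⟦_⟧ctx : Ctx → Obj
    ⟦ ∙ ⟧ctx     = I
    ⟦ Δ ▸ τ ⟧ctx = ⟦ Δ ⟧ctx ⊗₀ ⟦ τ ⟧ty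

    ⟦++⟧ : ∀ Δ Δ′ → ⟦ Δ ++ Δ′ ⟧ctx ≡ ⟦ Δ ⟧ctx ⊗₀ ⟦ Δ′ ⟧ctx
    ⟦++⟧ Δ ∙        = sym unitʳ₀
    ⟦++⟧ Δ (Δ′ ▸ τ) = trans (cong (_⊗₀ ⟦ τ ⟧ty) (⟦++⟧ Δ Δ′)) assoc₀

    castDom : ∀ {A A′ B} → A ≡ A′ → Hom A′ B → Hom A B
    castDom p f = subst (λ X → Hom X _) (sym p) f

    castCod : ∀ {A B B′} → B ≡ B′ → Hom A B → Hom A B′
    castCod p f = subst (Hom _) p f

    module _ (⟦_⟧con : ∀ {τ} → K τ → Hom I ⟦ τ ⟧ty) where

      ⟦_⟧ : ∀ {Δ σ} → Term Δ σ → Hom ⟦ Δ ⟧ctx ⟦ σ ⟧ty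
      ⟦_⟧ {Δ} (con c) = ⟦ c ⟧con ∘ bot ⟦ Δ ⟧ctx
      -- ⊥_Δ₁ ⊗ id_τ ⊗ ⊥_Δ₂ , using  ⟦Δ⟧ = ⟦Δ₁⟧ ⊗ ⟦τ⟧ ⊗ ⟦Δ₂⟧  and  I ⊗ ⟦τ⟧ ⊗ I = ⟦τ⟧
      ⟦ var {τ} Δ₁ Δ₂ eq ⟧ =
        castDom (trans (cong ⟦_⟧ctx eq) (⟦++⟧ (Δ₁ ▸ τ) Δ₂))
          (castCod (trans unitʳ₀ unitˡ₀)
            ((bot ⟦ Δ₁ ⟧ctx ⊗₁ id {⟦ τ ⟧ty}) ⊗₁ bot ⟦ Δ₂ ⟧ctx))
      ⟦ lam t ⟧ = Λ ⟦ t ⟧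
      ⟦ app Δ₁ Δ₂ eq t u ⟧ =
        castDom (trans (cong ⟦_⟧ctx eq) (⟦++⟧ Δ₁ Δ₂)) (ev ∘ (⟦ t ⟧ ⊗₁ ⟦ u ⟧))

{-# OPTIONS --safe #-}
-- Weakenings and substitutions are interpreted as morphisms between context
-- objects, every discarded variable being sent to ⊥. Renaming and substitution
-- are then lax: ⟦ t [ s ] ⟧ ≤ ⟦ t ⟧ ∘ ⟦ s ⟧, the inequality arising exactly where
-- a discarded piece ⊥ ∘ g (of a constant, or next to a variable) is replaced by
-- the least map ⊥. A redex (λx.t) u denotes ev ∘ (Λ⟦t⟧ ⊗ ⟦u⟧) = ⟦t⟧ ∘ (id ⊗ ⟦u⟧),
-- which by the substitution lemma lies above ⟦ t [ u / x ] ⟧; the congruence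
-- rules follow from monotonicity of ∘, ⊗ and Λ.
module Submission where

open import Defs
open import Level using (Level; _⊔_)
open import Data.Product using (Σ-syntax; _×_; _,_)
open import Relation.Binary.PropositionalEquality
  using (_≡_; refl; sym; trans; cong; cong₂; subst; subst₂; module ≡-Reasoning)
open import Relation.Binary.Structures using (IsPartialOrder)

module MorphismCalculus {lo lh le : Level} (𝒞 : PosetStrictMonClosed lo lh le) where
  open PosetStrictMonClosed 𝒞

  module ≤ {A B : Obj} = IsPartialOrder (≤-isPartialOrder {A} {B})

  -- The strict monoidal laws hold only up to transport along equalities of
  -- objects, so morphisms must be compared across equal hom-sets.
  infix 4 _≋_
  data _≋_ {A B : Obj} (f : Hom A B) : ∀ {A′ B′} → Hom A′ B′ → Set (lo ⊔ lh) where
    ≋-refl : f ≋ f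

  ≋-sym : ∀ {A B A′ B′} {f : Hom A B} {g : Hom A′ B′} → f ≋ g → g ≋ f
  ≋-sym ≋-refl = ≋-refl

  infixr 5 _⨾_
  _⨾_ : ∀ {A B A′ B′ A″ B″} {f : Hom A B} {g : Hom A′ B′} {h : Hom A″ B″}
      → f ≋ g → g ≋ h → f ≋ h
  ≋-refl ⨾ g≋h = g≋h

  ≡⇒≋ : ∀ {A B} {f g : Hom A B} → f ≡ g → f ≋ g
  ≡⇒≋ refl = ≋-refl

  ≋⇒≡ : ∀ {A B} {f g : Hom A B} → f ≋ g → f ≡ g
  ≋⇒≡ ≋-refl = refl

  subst₂-≋ : ∀ {A B A′ B′} (p : A ≡ A′) (q : B ≡ B′) (f : Hom A B)
           → subst₂ Hom p q f ≋ f
  subst₂-≋ refl refl f = ≋-refl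

  subst-dom-≋ : ∀ {A A′ B} (p : A ≡ A′) (f : Hom A B) → subst (λ X → Hom X B) p f ≋ f
  subst-dom-≋ refl f = ≋-refl

  subst-cod-≋ : ∀ {A B B′} (p : B ≡ B′) (f : Hom A B) → subst (Hom A) p f ≋ f
  subst-cod-≋ refl f = ≋-refl

  subst-dom-mono : ∀ {A A′ B} (p : A ≡ A′) {f g : Hom A B}
                 → f ≤ g → subst (λ X → Hom X B) p f ≤ subst (λ X → Hom X B) p g
  subst-dom-mono refl f≤g = f≤g

  ∘-cong : ∀ {A B C A′ B′ C′} {f : Hom B C} {g : Hom A B} {f′ : Hom B′ C′} {g′ : Hom A′ B′}
         → f ≋ f′ → g ≋ g′ → f ∘ g ≋ f′ ∘ g′
  ∘-cong ≋-refl ≋-refl = ≋-refl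

  ⊗-cong : ∀ {A B C D A′ B′ C′ D′}
             {f : Hom A B} {g : Hom C D} {f′ : Hom A′ B′} {g′ : Hom C′ D′}
         → f ≋ f′ → g ≋ g′ → f ⊗₁ g ≋ f′ ⊗₁ g′
  ⊗-cong ≋-refl ≋-refl = ≋-refl

  bot-cong : ∀ {X Y} → X ≡ Y → bot X ≋ bot Y
  bot-cong refl = ≋-refl

  assoc₁-≋ : ∀ {A B C D E F} {f : Hom A B} {g : Hom C D} {h : Hom E F}
           → (f ⊗₁ g) ⊗₁ h ≋ f ⊗₁ (g ⊗₁ h)
  assoc₁-≋ = ≋-sym (subst₂-≋ assoc₀ assoc₀ _) ⨾ ≡⇒≋ assoc₁

  unitˡ₁-≋ : ∀ {A B} {f : Hom A B} → id {I} ⊗₁ f ≋ f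
  unitˡ₁-≋ = ≋-sym (subst₂-≋ unitˡ₀ unitˡ₀ _) ⨾ ≡⇒≋ unitˡ₁

  unitʳ₁-≋ : ∀ {A B} {f : Hom A B} → f ⊗₁ id {I} ≋ f
  unitʳ₁-≋ = ≋-sym (subst₂-≋ unitʳ₀ unitʳ₀ _) ⨾ ≡⇒≋ unitʳ₁

  bot-⊗-≋ : ∀ {X Y} → bot X ⊗₁ bot Y ≋ bot (X ⊗₀ Y)
  bot-⊗-≋ = ≋-sym (subst-cod-≋ unitˡ₀ _) ⨾ ≡⇒≋ bot-⊗

  ⊗-∘-factorˡ : ∀ {A B C A′ B′} {f : Hom B C} {g : Hom A B} {h : Hom A′ B′}
              → (f ∘ g) ⊗₁ h ≡ (f ⊗₁ id) ∘ (g ⊗₁ h)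
  ⊗-∘-factorˡ {f = f} {g} = trans (cong ((f ∘ g) ⊗₁_) (sym identityˡ)) ⊗-∘

  ⊗-interchange-middle : ∀ {X X′ Y Y′ A B} (a : Hom X X′) (f : Hom A B) (b : Hom Y Y′)
                       → ((id ⊗₁ f) ⊗₁ id) ∘ ((a ⊗₁ id) ⊗₁ b) ≡ (a ⊗₁ f) ⊗₁ b
  ⊗-interchange-middle a f b = begin
    ((id ⊗₁ f) ⊗₁ id) ∘ ((a ⊗₁ id) ⊗₁ b)  ≡⟨ sym ⊗-∘ ⟩
    ((id ⊗₁ f) ∘ (a ⊗₁ id)) ⊗₁ (id ∘ b)   ≡⟨ cong₂ _⊗₁_ (sym ⊗-∘) identityˡ ⟩
    ((id ∘ a) ⊗₁ (f ∘ id)) ⊗₁ b           ≡⟨ cong (_⊗₁ b) (cong₂ _⊗₁_ identityˡ identityʳ) ⟩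
    (a ⊗₁ f) ⊗₁ b                         ∎
    where open ≡-Reasoning

  Λ-natural : ∀ {X X′ Y Z} (f : Hom (X ⊗₀ Y) Z) (g : Hom X′ X)
            → Λ f ∘ g ≡ Λ (f ∘ (g ⊗₁ id))
  Λ-natural f g = begin
    Λ f ∘ g                             ≡⟨ sym Λ-η ⟩
    Λ (ev ∘ ((Λ f ∘ g) ⊗₁ id))          ≡⟨ cong (λ k → Λ (ev ∘ k)) ⊗-∘-factorˡ ⟩
    Λ (ev ∘ ((Λ f ⊗₁ id) ∘ (g ⊗₁ id)))  ≡⟨ cong Λ (sym assoc) ⟩
    Λ ((ev ∘ (Λ f ⊗₁ id)) ∘ (g ⊗₁ id))  ≡⟨ cong (λ k → Λ (k ∘ (g ⊗₁ id))) Λ-β ⟩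
    Λ (f ∘ (g ⊗₁ id))                   ∎
    where open ≡-Reasoning

  Λ-lax : ∀ {X X′ Y Z} {f : Hom (X ⊗₀ Y) Z} {f′ : Hom (X′ ⊗₀ Y) Z} {g : Hom X′ X}
        → f′ ≤ f ∘ (g ⊗₁ id) → Λ f′ ≤ Λ f ∘ g
  Λ-lax {f = f} {g = g} f′≤ = ≤.trans (Λ-mono f′≤) (≤.reflexive (sym (Λ-natural f g)))

  Λ-β-⊗ : ∀ {X Y Z W} (f : Hom (X ⊗₀ Y) Z) (g : Hom W Y)
        → ev ∘ (Λ f ⊗₁ g) ≡ f ∘ (id ⊗₁ g)
  Λ-β-⊗ f g = begin
    ev ∘ (Λ f ⊗₁ g)                 ≡⟨ cong (ev ∘_) (cong₂ _⊗₁_ (sym identityʳ) (sym identityˡ)) ⟩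
    ev ∘ ((Λ f ∘ id) ⊗₁ (id ∘ g))   ≡⟨ cong (ev ∘_) ⊗-∘ ⟩
    ev ∘ ((Λ f ⊗₁ id) ∘ (id ⊗₁ g))  ≡⟨ sym assoc ⟩
    (ev ∘ (Λ f ⊗₁ id)) ∘ (id ⊗₁ g)  ≡⟨ cong (_∘ (id ⊗₁ g)) Λ-β ⟩
    f ∘ (id ⊗₁ g)                   ∎
    where open ≡-Reasoning

  infix 4 _≼_
  data _≼_ {A B : Obj} (f : Hom A B) {A′ B′ : Obj} (g : Hom A′ B′) : Set (lo ⊔ lh ⊔ le) where
    ≤-≋ : ∀ {h} → f ≤ h → h ≋ g → f ≼ g

  ≤⇒≼ : ∀ {A B} {f g : Hom A B} → f ≤ g → f ≼ g
  ≤⇒≼ f≤g = ≤-≋ f≤g ≋-refl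

  ⊗-mono-≼ : ∀ {A B C D A′ B′ C′ D′}
               {f : Hom A B} {g : Hom C D} {f′ : Hom A′ B′} {g′ : Hom C′ D′}
           → f ≼ f′ → g ≼ g′ → f ⊗₁ g ≼ f′ ⊗₁ g′
  ⊗-mono-≼ (≤-≋ f≤ ≋-refl) (≤-≋ g≤ ≋-refl) = ≤⇒≼ (⊗-mono f≤ g≤)

  module ≼-Reasoning where
    infix  1 begin_
    infixr 2 _≋⟨_⟩_ _≡⟨_⟩_ _≤⟨_⟩_ _≼⟨_⟩_
    infix  3 _∎

    begin_ : ∀ {A B} {f g : Hom A B} → f ≼ g → f ≤ g
    begin ≤-≋ f≤g ≋-refl = f≤g

    _≋⟨_⟩_ : ∀ {A B A′ B′ A″ B″} (f : Hom A B) {g : Hom A′ B′} {h : Hom A″ B″}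
           → f ≋ g → g ≼ h → f ≼ h
    f ≋⟨ ≋-refl ⟩ g≼h = g≼h

    _≡⟨_⟩_ : ∀ {A B A″ B″} (f : Hom A B) {g : Hom A B} {h : Hom A″ B″}
           → f ≡ g → g ≼ h → f ≼ h
    f ≡⟨ refl ⟩ g≼h = g≼h

    _≤⟨_⟩_ : ∀ {A B A″ B″} (f : Hom A B) {g : Hom A B} {h : Hom A″ B″}
           → f ≤ g → g ≼ h → f ≼ h
    f ≤⟨ f≤g ⟩ ≤-≋ g≤k k≋h = ≤-≋ (≤.trans f≤g g≤k) k≋h

    _≼⟨_⟩_ : ∀ {A B A′ B′ A″ B″} (f : Hom A B) {g : Hom A′ B′} {h : Hom A″ B″}
           → f ≼ g → g ≼ h → f ≼ h
    f ≼⟨ ≤-≋ f≤g ≋-refl ⟩ g≼h = f ≤⟨ f≤g ⟩ g≼h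

    _∎ : ∀ {A B} (f : Hom A B) → f ≼ f
    f ∎ = ≤⇒≼ ≤.refl

module Soundness {lo lh le : Level} (𝒞 : PosetStrictMonClosed lo lh le) (K : Ty → Set)
  (⟦o⟧ : PosetStrictMonClosed.Obj 𝒞)
  (κ : ∀ {τ} → K τ → PosetStrictMonClosed.Hom 𝒞 (PosetStrictMonClosed.I 𝒞)
                                             (Semantics.Interp.⟦_⟧ty 𝒞 K ⟦o⟧ τ))
  where
  open PosetStrictMonClosed 𝒞
  open MorphismCalculus 𝒞
  open ≼-Reasoning
  open Syntax K
  open Semantics.Interp 𝒞 K ⟦o⟧ renaming (⟦_⟧ to interpret)

  ⟦_⟧ : ∀ {Δ σ} → Term Δ σ → Hom ⟦ Δ ⟧ctx ⟦ σ ⟧ty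
  ⟦_⟧ = interpret κ

  ⊥[_] : (Δ : Ctx) → Hom ⟦ Δ ⟧ctx I
  ⊥[ Δ ] = bot ⟦ Δ ⟧ctx

  ⟦var⟧-≋ : ∀ {Δ τ} Δ₁ Δ₂ (eq : Δ ≡ (Δ₁ ▸ τ) ++ Δ₂)
          → ⟦ var Δ₁ Δ₂ eq ⟧ ≋ (⊥[ Δ₁ ] ⊗₁ id {⟦ τ ⟧ty}) ⊗₁ ⊥[ Δ₂ ]
  ⟦var⟧-≋ {τ = τ} Δ₁ Δ₂ eq =
    subst-dom-≋ (sym (trans (cong ⟦_⟧ctx eq) (⟦++⟧ (Δ₁ ▸ τ) Δ₂))) _ ⨾ subst-cod-≋ _ _

  ⟦sole-var⟧-≋-id : ∀ {τ} → ⟦ var {τ = τ} ∙ ∙ refl ⟧ ≋ id {⟦ τ ⟧ty}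
  ⟦sole-var⟧-≋-id {τ} =
    ⟦var⟧-≋ {τ = τ} ∙ ∙ refl ⨾ ⊗-cong (⊗-cong (≡⇒≋ bot-I) ≋-refl) (≡⇒≋ bot-I)
    ⨾ unitʳ₁-≋ ⨾ unitˡ₁-≋

  ⟦app⟧-≋ : ∀ {Δ Δ₁ Δ₂ τ σ} (eq : Δ ≡ Δ₁ ++ Δ₂) (t : Term Δ₁ (τ ⇒ σ)) (u : Term Δ₂ τ)
          → ⟦ app Δ₁ Δ₂ eq t u ⟧ ≋ ev ∘ (⟦ t ⟧ ⊗₁ ⟦ u ⟧)
  ⟦app⟧-≋ eq t u = subst-dom-≋ _ (ev ∘ (⟦ t ⟧ ⊗₁ ⟦ u ⟧))

  ⟦app⟧-mono : ∀ {Δ Δ₁ Δ₂ τ σ} (eq : Δ ≡ Δ₁ ++ Δ₂)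
                 (t t′ : Term Δ₁ (τ ⇒ σ)) (u u′ : Term Δ₂ τ)
             → ⟦ t′ ⟧ ≤ ⟦ t ⟧ → ⟦ u′ ⟧ ≤ ⟦ u ⟧
             → ⟦ app Δ₁ Δ₂ eq t′ u′ ⟧ ≤ ⟦ app Δ₁ Δ₂ eq t u ⟧
  ⟦app⟧-mono {Δ₁ = Δ₁} {Δ₂} eq _ _ _ _ t′≤t u′≤u =
    subst-dom-mono (sym (trans (cong ⟦_⟧ctx eq) (⟦++⟧ Δ₁ Δ₂)))
                   (∘-mono ≤.refl (⊗-mono t′≤t u′≤u))

  ⟦con⟧-lax : ∀ {Δ Θ τ} (c : K τ) (g : Hom ⟦ Θ ⟧ctx ⟦ Δ ⟧ctx)
            → ⟦ con {Θ} c ⟧ ≤ ⟦ con {Δ} c ⟧ ∘ g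
  ⟦con⟧-lax {Δ} c g =
    ≤.trans (∘-mono ≤.refl (bot-least (⊥[ Δ ] ∘ g))) (≤.reflexive (sym assoc))

  ⟦app⟧-lax : ∀ {Δ₁ Δ₂ Θ₁ Θ₂ Θ τ σ} (eq : Θ ≡ Θ₁ ++ Θ₂)
                (t : Term Δ₁ (τ ⇒ σ)) (u : Term Δ₂ τ) (t′ : Term Θ₁ (τ ⇒ σ)) (u′ : Term Θ₂ τ)
                {f : Hom ⟦ Θ₁ ⟧ctx ⟦ Δ₁ ⟧ctx} {g : Hom ⟦ Θ₂ ⟧ctx ⟦ Δ₂ ⟧ctx}
                {h : Hom ⟦ Θ ⟧ctx ⟦ Δ₁ ++ Δ₂ ⟧ctx}
            → ⟦ t′ ⟧ ≤ ⟦ t ⟧ ∘ f → ⟦ u′ ⟧ ≤ ⟦ u ⟧ ∘ g → h ≋ f ⊗₁ g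
            → ⟦ app Θ₁ Θ₂ eq t′ u′ ⟧ ≤ ⟦ app Δ₁ Δ₂ refl t u ⟧ ∘ h
  ⟦app⟧-lax eq t u t′ u′ {f} {g} {h} t′≤ u′≤ h≋ = begin
    ⟦ app _ _ eq t′ u′ ⟧                ≋⟨ ⟦app⟧-≋ eq t′ u′ ⟩
    ev ∘ (⟦ t′ ⟧ ⊗₁ ⟦ u′ ⟧)             ≤⟨ ∘-mono ≤.refl (⊗-mono t′≤ u′≤) ⟩
    ev ∘ ((⟦ t ⟧ ∘ f) ⊗₁ (⟦ u ⟧ ∘ g))   ≡⟨ trans (cong (ev ∘_) ⊗-∘) (sym assoc) ⟩
    (ev ∘ (⟦ t ⟧ ⊗₁ ⟦ u ⟧)) ∘ (f ⊗₁ g)  ≋⟨ ∘-cong (≋-sym (⟦app⟧-≋ refl t u)) (≋-sym h≋) ⟩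
    ⟦ app _ _ refl t u ⟧ ∘ h            ∎

  ⟦_⟧⊑ : ∀ {Δ Θ} → Δ ⊑ Θ → Hom ⟦ Θ ⟧ctx ⟦ Δ ⟧ctx
  ⟦ done ⟧⊑           = id
  ⟦ keep e ⟧⊑         = ⟦ e ⟧⊑ ⊗₁ id
  ⟦ drop {τ = τ} e ⟧⊑ = castCod unitʳ₀ (⟦ e ⟧⊑ ⊗₁ bot ⟦ τ ⟧ty)

  ⟦drop⟧-≋ : ∀ {Δ Θ} τ (e : Δ ⊑ Θ) → ⟦ drop {τ = τ} e ⟧⊑ ≋ ⟦ e ⟧⊑ ⊗₁ bot ⟦ τ ⟧ty
  ⟦drop⟧-≋ τ e = subst-cod-≋ unitʳ₀ _

  -- Facts about splitOPE, varPos and splitSub are stated as predicates on their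
  -- results, so that `with` abstracts those results in the lemma's type as well.
  SplitOPE-≋ : ∀ {Θ} Δa Δb → (Δa ++ Δb) ⊑ Θ
             → Σ[ Θa ∈ Ctx ] Σ[ Θb ∈ Ctx ] (Δa ⊑ Θa × Δb ⊑ Θb × Θ ≡ Θa ++ Θb)
             → Set (lo ⊔ lh)
  SplitOPE-≋ Δa Δb e (_ , _ , ea , eb , _) = ⟦ e ⟧⊑ ≋ ⟦ ea ⟧⊑ ⊗₁ ⟦ eb ⟧⊑

  ⟦splitOPE⟧ : ∀ {Θ} Δa Δb (e : (Δa ++ Δb) ⊑ Θ) → SplitOPE-≋ Δa Δb e (splitOPE Δa Δb e)
  ⟦splitOPE⟧ Δa ∙ e = ≋-sym unitʳ₁-≋
  ⟦splitOPE⟧ Δa (Δb ▸ τ) (keep e) with splitOPE Δa Δb e | ⟦splitOPE⟧ Δa Δb e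
  ... | _ , _ , _ , _ , _ | e≋ = ⊗-cong e≋ ≋-refl ⨾ assoc₁-≋
  ⟦splitOPE⟧ Δa (Δb ▸ τ) (drop {τ = ρ} e)
    with splitOPE Δa (Δb ▸ τ) e | ⟦splitOPE⟧ Δa (Δb ▸ τ) e
  ... | _ , _ , _ , eb , _ | e≋ =
    ⟦drop⟧-≋ ρ e ⨾ ⊗-cong e≋ ≋-refl ⨾ assoc₁-≋ ⨾ ⊗-cong ≋-refl (≋-sym (⟦drop⟧-≋ ρ eb))

  VarPos-≼ : ∀ {Δ τ Θ} → (Δ ▸ τ) ⊑ Θ → Σ[ Θ₁ ∈ Ctx ] Σ[ Θ₂ ∈ Ctx ] (Θ ≡ (Θ₁ ▸ τ) ++ Θ₂)
           → Set (lo ⊔ lh ⊔ le)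
  VarPos-≼ {Δ} {τ} e (Θ₁ , Θ₂ , _) =
    (⊥[ Θ₁ ] ⊗₁ id {⟦ τ ⟧ty}) ⊗₁ ⊥[ Θ₂ ] ≼ (⊥[ Δ ] ⊗₁ id) ∘ ⟦ e ⟧⊑

  ⟦varPos⟧ : ∀ {Δ τ Θ} (e : (Δ ▸ τ) ⊑ Θ) → VarPos-≼ e (varPos e)
  ⟦varPos⟧ {Δ} (keep {Θ = Θ} e) =
    (⊥[ Θ ] ⊗₁ id) ⊗₁ bot I          ≋⟨ ⊗-cong ≋-refl (≡⇒≋ bot-I) ⨾ unitʳ₁-≋ ⟩
    ⊥[ Θ ] ⊗₁ id                     ≤⟨ ⊗-mono (bot-least (⊥[ Δ ] ∘ ⟦ e ⟧⊑)) ≤.refl ⟩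
    (⊥[ Δ ] ∘ ⟦ e ⟧⊑) ⊗₁ id          ≡⟨ ⊗-∘-factorˡ ⟩
    (⊥[ Δ ] ⊗₁ id) ∘ (⟦ e ⟧⊑ ⊗₁ id)  ∎
  ⟦varPos⟧ {Δ} (drop {τ = ρ} e) with varPos e | ⟦varPos⟧ e
  ... | Θ₁ , Θ₂ , _ | e≽ =
    (⊥[ Θ₁ ] ⊗₁ id) ⊗₁ ⊥[ Θ₂ ▸ ρ ]
      ≋⟨ ⊗-cong ≋-refl (≋-sym bot-⊗-≋) ⨾ ≋-sym assoc₁-≋ ⟩
    ((⊥[ Θ₁ ] ⊗₁ id) ⊗₁ ⊥[ Θ₂ ]) ⊗₁ bot ⟦ ρ ⟧ty
      ≼⟨ ⊗-mono-≼ e≽ (≤⇒≼ ≤.refl) ⟩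
    ((⊥[ Δ ] ⊗₁ id) ∘ ⟦ e ⟧⊑) ⊗₁ bot ⟦ ρ ⟧ty
      ≡⟨ ⊗-∘-factorˡ ⟩
    ((⊥[ Δ ] ⊗₁ id) ⊗₁ id) ∘ (⟦ e ⟧⊑ ⊗₁ bot ⟦ ρ ⟧ty)
      ≋⟨ ∘-cong unitʳ₁-≋ (≋-sym (⟦drop⟧-≋ ρ e)) ⟩
    (⊥[ Δ ] ⊗₁ id) ∘ ⟦ drop {τ = ρ} e ⟧⊑
      ∎

  ⟦dropAll⟧-≋ : ∀ Θ → ⟦ dropAll Θ ⟧⊑ ≋ ⊥[ Θ ]
  ⟦dropAll⟧-≋ ∙       = ≋-sym (≡⇒≋ bot-I)
  ⟦dropAll⟧-≋ (Θ ▸ τ) = ⟦drop⟧-≋ τ (dropAll Θ) ⨾ ⊗-cong (⟦dropAll⟧-≋ Θ) ≋-refl ⨾ bot-⊗-≋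

  ⟦padL⟧-≋ : ∀ Θl Δ → ⟦ padL Θl Δ ⟧⊑ ≋ ⊥[ Θl ] ⊗₁ id {⟦ Δ ⟧ctx}
  ⟦padL⟧-≋ Θl ∙       = ⟦dropAll⟧-≋ Θl ⨾ ≋-sym unitʳ₁-≋
  ⟦padL⟧-≋ Θl (Δ ▸ τ) = ⊗-cong (⟦padL⟧-≋ Θl Δ) ≋-refl ⨾ assoc₁-≋ ⨾ ⊗-cong ≋-refl (≡⇒≋ ⊗-id)

  ⟦padR⟧-≋ : ∀ {Δ Θ} (e : Δ ⊑ Θ) Θr → ⟦ padR e Θr ⟧⊑ ≋ ⟦ e ⟧⊑ ⊗₁ ⊥[ Θr ]
  ⟦padR⟧-≋ e ∙        = ≋-sym unitʳ₁-≋ ⨾ ⊗-cong ≋-refl (≡⇒≋ (sym bot-I))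
  ⟦padR⟧-≋ e (Θr ▸ τ) =
    ⟦drop⟧-≋ τ (padR e Θr) ⨾ ⊗-cong (⟦padR⟧-≋ e Θr) ≋-refl ⨾ assoc₁-≋ ⨾ ⊗-cong ≋-refl bot-⊗-≋

  ⟦rename⟧-≤ : ∀ {Δ Θ σ} (t : Term Δ σ) (e : Δ ⊑ Θ) → ⟦ rename t e ⟧ ≤ ⟦ t ⟧ ∘ ⟦ e ⟧⊑
  ⟦rename⟧-≤ {Δ} {Θ} (con c) e = ⟦con⟧-lax {Δ} {Θ} c ⟦ e ⟧⊑
  ⟦rename⟧-≤ (var {τ} Δ₁ Δ₂ refl) e
    with splitOPE (Δ₁ ▸ τ) Δ₂ e | ⟦splitOPE⟧ (Δ₁ ▸ τ) Δ₂ e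
  ... | _ , Θb , ea , eb , refl | e≋ with varPos ea | ⟦varPos⟧ ea
  ... | Θ₁ , Θ₂ , refl | ea≽ = begin
    ⟦ var Θ₁ (Θ₂ ++ Θb) (++-assoc (Θ₁ ▸ τ) Θ₂ Θb) ⟧
      ≋⟨ ⟦var⟧-≋ {τ = τ} Θ₁ (Θ₂ ++ Θb) (++-assoc (Θ₁ ▸ τ) Θ₂ Θb)
         ⨾ ⊗-cong ≋-refl (bot-cong (⟦++⟧ Θ₂ Θb) ⨾ ≋-sym bot-⊗-≋) ⨾ ≋-sym assoc₁-≋ ⟩
    ((⊥[ Θ₁ ] ⊗₁ id) ⊗₁ ⊥[ Θ₂ ]) ⊗₁ ⊥[ Θb ]
      ≼⟨ ⊗-mono-≼ ea≽ (≤⇒≼ (bot-least (⊥[ Δ₂ ] ∘ ⟦ eb ⟧⊑))) ⟩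
    ((⊥[ Δ₁ ] ⊗₁ id) ∘ ⟦ ea ⟧⊑) ⊗₁ (⊥[ Δ₂ ] ∘ ⟦ eb ⟧⊑)
      ≡⟨ ⊗-∘ ⟩
    ((⊥[ Δ₁ ] ⊗₁ id) ⊗₁ ⊥[ Δ₂ ]) ∘ (⟦ ea ⟧⊑ ⊗₁ ⟦ eb ⟧⊑)
      ≋⟨ ∘-cong (≋-sym (⟦var⟧-≋ Δ₁ Δ₂ refl)) (≋-sym e≋) ⟩
    ⟦ var Δ₁ Δ₂ refl ⟧ ∘ ⟦ e ⟧⊑
      ∎
  ⟦rename⟧-≤ (lam t) e = Λ-lax (⟦rename⟧-≤ t (keep e))
  ⟦rename⟧-≤ (app Δ₁ Δ₂ refl t u) e with splitOPE Δ₁ Δ₂ e | ⟦splitOPE⟧ Δ₁ Δ₂ e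
  ... | _ , _ , ea , eb , eq | e≋ =
    ⟦app⟧-lax eq t u (rename t ea) (rename u eb) (⟦rename⟧-≤ t ea) (⟦rename⟧-≤ u eb) e≋

  ⟦_⟧ˢ : ∀ {Δ Θ} → Sub Δ Θ → Hom ⟦ Θ ⟧ctx ⟦ Δ ⟧ctx
  ⟦ ε ⟧ˢ                         = id
  ⟦ _▷_ {Θ = Θ} {Θ′ = Θ′} s t ⟧ˢ = castDom (⟦++⟧ Θ Θ′) (⟦ s ⟧ˢ ⊗₁ ⟦ t ⟧)

  ⟦▷⟧-≋ : ∀ {Δ Θ Θ′ τ} (s : Sub Δ Θ) (t : Term Θ′ τ) → ⟦ s ▷ t ⟧ˢ ≋ ⟦ s ⟧ˢ ⊗₁ ⟦ t ⟧
  ⟦▷⟧-≋ {Θ = Θ} {Θ′} s t = subst-dom-≋ (sym (⟦++⟧ Θ Θ′)) (⟦ s ⟧ˢ ⊗₁ ⟦ t ⟧)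

  ⟦lift⟧ : ∀ {Δ Θ τ} (s : Sub Δ Θ) → ⟦ s ▷ var {τ = τ} ∙ ∙ refl ⟧ˢ ≡ ⟦ s ⟧ˢ ⊗₁ id
  ⟦lift⟧ {τ = τ} s =
    ≋⇒≡ (⟦▷⟧-≋ s (var {τ = τ} ∙ ∙ refl) ⨾ ⊗-cong ≋-refl (⟦sole-var⟧-≋-id {τ}))

  ⟦idSub⟧-≋-id : ∀ Δ → ⟦ idSub Δ ⟧ˢ ≋ id {⟦ Δ ⟧ctx}
  ⟦idSub⟧-≋-id ∙       = ≋-refl
  ⟦idSub⟧-≋-id (Δ ▸ τ) =
    ≡⇒≋ (⟦lift⟧ {τ = τ} (idSub Δ)) ⨾ ⊗-cong (⟦idSub⟧-≋-id Δ) ≋-refl ⨾ ≡⇒≋ ⊗-id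

  SplitSub-≋ : ∀ {Θ} Δa Δb → Sub (Δa ++ Δb) Θ
             → Σ[ Θa ∈ Ctx ] Σ[ Θb ∈ Ctx ] (Sub Δa Θa × Sub Δb Θb × Θ ≡ Θa ++ Θb)
             → Set (lo ⊔ lh)
  SplitSub-≋ Δa Δb s (_ , _ , sa , sb , _) = ⟦ s ⟧ˢ ≋ ⟦ sa ⟧ˢ ⊗₁ ⟦ sb ⟧ˢ

  ⟦splitSub⟧ : ∀ {Θ} Δa Δb (s : Sub (Δa ++ Δb) Θ) → SplitSub-≋ Δa Δb s (splitSub Δa Δb s)
  ⟦splitSub⟧ Δa ∙ s = ≋-sym unitʳ₁-≋
  ⟦splitSub⟧ Δa (Δb ▸ τ) (s ▷ t) with splitSub Δa Δb s | ⟦splitSub⟧ Δa Δb s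
  ... | _ , _ , _ , sb , _ | s≋ =
    ⟦▷⟧-≋ s t ⨾ ⊗-cong s≋ ≋-refl ⨾ assoc₁-≋ ⨾ ⊗-cong ≋-refl (≋-sym (⟦▷⟧-≋ sb t))

  ⟦sub⟧-≤ : ∀ {Δ Θ σ} (t : Term Δ σ) (s : Sub Δ Θ) → ⟦ sub t s ⟧ ≤ ⟦ t ⟧ ∘ ⟦ s ⟧ˢ
  ⟦sub⟧-≤ {Δ} {Θ} (con c) s = ⟦con⟧-lax {Δ} {Θ} c ⟦ s ⟧ˢ
  ⟦sub⟧-≤ (var {τ} Δ₁ Δ₂ refl) s with splitSub (Δ₁ ▸ τ) Δ₂ s | ⟦splitSub⟧ (Δ₁ ▸ τ) Δ₂ s
  ... | _ , Θb , _▷_ {Θ = Θ₁} {Θ′ = Θu} s₁ u , sb , refl | s≋ = begin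
    ⟦ rename u (padR (padL Θ₁ Θu) Θb) ⟧
      ≤⟨ ⟦rename⟧-≤ u (padR (padL Θ₁ Θu) Θb) ⟩
    ⟦ u ⟧ ∘ ⟦ padR (padL Θ₁ Θu) Θb ⟧⊑
      ≋⟨ ∘-cong (≋-sym (unitʳ₁-≋ ⨾ unitˡ₁-≋))
                (⟦padR⟧-≋ (padL Θ₁ Θu) Θb ⨾ ⊗-cong (⟦padL⟧-≋ Θ₁ Θu) ≋-refl) ⟩
    ((id ⊗₁ ⟦ u ⟧) ⊗₁ id) ∘ ((⊥[ Θ₁ ] ⊗₁ id) ⊗₁ ⊥[ Θb ])
      ≡⟨ ⊗-interchange-middle ⊥[ Θ₁ ] ⟦ u ⟧ ⊥[ Θb ] ⟩
    (⊥[ Θ₁ ] ⊗₁ ⟦ u ⟧) ⊗₁ ⊥[ Θb ]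
      ≤⟨ ⊗-mono (⊗-mono (bot-least (⊥[ Δ₁ ] ∘ ⟦ s₁ ⟧ˢ)) (≤.reflexive (sym identityˡ)))
                (bot-least (⊥[ Δ₂ ] ∘ ⟦ sb ⟧ˢ)) ⟩
    ((⊥[ Δ₁ ] ∘ ⟦ s₁ ⟧ˢ) ⊗₁ (id ∘ ⟦ u ⟧)) ⊗₁ (⊥[ Δ₂ ] ∘ ⟦ sb ⟧ˢ)
      ≡⟨ trans (cong (_⊗₁ (⊥[ Δ₂ ] ∘ ⟦ sb ⟧ˢ)) ⊗-∘) ⊗-∘ ⟩
    ((⊥[ Δ₁ ] ⊗₁ id) ⊗₁ ⊥[ Δ₂ ]) ∘ ((⟦ s₁ ⟧ˢ ⊗₁ ⟦ u ⟧) ⊗₁ ⟦ sb ⟧ˢ)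
      ≋⟨ ∘-cong (≋-sym (⟦var⟧-≋ Δ₁ Δ₂ refl)) (≋-sym (s≋ ⨾ ⊗-cong (⟦▷⟧-≋ s₁ u) ≋-refl)) ⟩
    ⟦ var Δ₁ Δ₂ refl ⟧ ∘ ⟦ s ⟧ˢ
      ∎
  ⟦sub⟧-≤ (lam {τ} t) s =
    Λ-lax (≤.trans (⟦sub⟧-≤ t (s ▷ var ∙ ∙ refl))
                   (≤.reflexive (cong (⟦ t ⟧ ∘_) (⟦lift⟧ {τ = τ} s))))
  ⟦sub⟧-≤ (app Δ₁ Δ₂ refl t u) s with splitSub Δ₁ Δ₂ s | ⟦splitSub⟧ Δ₁ Δ₂ s
  ... | _ , _ , sa , sb , eq | s≋ =
    ⟦app⟧-lax eq t u (sub t sa) (sub u sb) (⟦sub⟧-≤ t sa) (⟦sub⟧-≤ u sb) s≋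

  ⟦[/x]⟧-≼ : ∀ {Δ₁ Δ₂ τ σ} (t : Term (Δ₁ ▸ τ) σ) (u : Term Δ₂ τ)
           → ⟦ t [ u /x] ⟧ ≼ ⟦ t ⟧ ∘ (id ⊗₁ ⟦ u ⟧)
  ⟦[/x]⟧-≼ {Δ₁} t u =
    ⟦ t [ u /x] ⟧              ≤⟨ ⟦sub⟧-≤ t (idSub Δ₁ ▷ u) ⟩
    ⟦ t ⟧ ∘ ⟦ idSub Δ₁ ▷ u ⟧ˢ  ≋⟨ ∘-cong ≋-refl (⟦▷⟧-≋ (idSub Δ₁) u
                                              ⨾ ⊗-cong (⟦idSub⟧-≋-id Δ₁) ≋-refl) ⟩
    ⟦ t ⟧ ∘ (id ⊗₁ ⟦ u ⟧)      ∎

  →β⇒≥ : ∀ {Δ σ} {t u : Term Δ σ} → t →β u → ⟦ u ⟧ ≤ ⟦ t ⟧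
  →β⇒≥ (β refl t u) = begin
    ⟦ t [ u /x] ⟧               ≼⟨ ⟦[/x]⟧-≼ t u ⟩
    ⟦ t ⟧ ∘ (id ⊗₁ ⟦ u ⟧)       ≡⟨ sym (Λ-β-⊗ ⟦ t ⟧ ⟦ u ⟧) ⟩
    ev ∘ (Λ ⟦ t ⟧ ⊗₁ ⟦ u ⟧)     ≋⟨ ≋-sym (⟦app⟧-≋ refl (lam t) u) ⟩
    ⟦ app _ _ refl (lam t) u ⟧  ∎
  →β⇒≥ (ξ-lam t→t′)                  = Λ-mono (→β⇒≥ t→t′)
  →β⇒≥ (ξ-appˡ eq {t} {t′} {u} t→t′) = ⟦app⟧-mono eq t t′ u u (→β⇒≥ t→t′) ≤.refl
  →β⇒≥ (ξ-appʳ eq {t} {u} {u′} u→u′) = ⟦app⟧-mono eq t t u u′ ≤.refl (→β⇒≥ u→u′)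

corollary4p4 : ∀ {lo lh le} (𝒞 : PosetStrictMonClosed lo lh le) (K : Ty → Set)
                 (⟦o⟧ : PosetStrictMonClosed.Obj 𝒞)
                 (κ : ∀ {τ} → K τ → PosetStrictMonClosed.Hom 𝒞 (PosetStrictMonClosed.I 𝒞)
                                      (Semantics.Interp.⟦_⟧ty 𝒞 K ⟦o⟧ τ))
                 {Δ : Ctx} {σ : Ty} {t u : Syntax.Term K Δ σ}
               → Syntax._→β_ K t u
               → PosetStrictMonClosed._≤_ 𝒞 (Semantics.Interp.⟦_⟧ 𝒞 K ⟦o⟧ κ u)
                                             (Semantics.Interp.⟦_⟧ 𝒞 K ⟦o⟧ κ t)
corollary4p4 𝒞 K ⟦o⟧ κ = Soundness.→β⇒≥ 𝒞 K ⟦o⟧ κ
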